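{- Let $\mathcal S\subseteq\mathbf{\Psi}$ be a stable on-target set of polymers with concentration exponents $\mu$, and let $\bar\mu:\mathbf{\Psi}\to\mathbb{R}^+$ be the extended concentration exponent produced by the level construction. Then $\bar\mu(P)>1$ for all $P\notin\mathcal S$.
   Context: Multisets: a multiset $M$ over a finite set $A$ is a function $A\to\mathbb{N}$, $M[a]$ the count of $a$, $a\in M$ means $M[a]\ge1$, $|M|=\sum_aM[a]$, sums pointwise, $M_1-M_2$ pointwise difference (when defined), $M\cap S$ agrees with $M$ on $S$ and is $0$ elsewhere; $\mathbb{N}^S$ denotes multisets over $S$. Setting: $\mathbf{\Psi^0}$ a finite set of monomers; $\mathbf{\Psi}\subseteq\mathbb{N}^{\mathbf{\Psi^0}}$ a finite set of polymers. $M_1,M_2\in\mathbb{N}^{\mathbf{\Psi}}$ are reconfigurations, $M_1\cong M_2$, if for every monomer $m$, $\sum_PM_1[P]P[m]=\sum_PM_2[P]P[m]$; then $M_1\to M_2$ is a reaction. On-target set: $\mathcal S\subseteq\mathbf{\Psi}$ with $\mu:\mathcal S\to(0,1]$ such that (1) every $P\in\mathbf{\Psi}$ lies in some $M'$ with $M\cong M'$ for some $M\in\mathbb{N}^{\mathcal S}$; (2) $\mu(M_1)=\mu(M_2)$ whenever $M_1,M_2\in\mathbb{N}^{\mathcal S}$, $M_1\cong M_2$, where $\mu(M)=\sum_PM[P]\mu(P)$. A reaction $M_1\to M_2$ is canonical if $M_1\in\mathbb{N}^{\mathcal S}$; $k(\alpha)=\mu(M_1)-\mu(M_2\cap\mathcal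 S)$, $l(\alpha)=|M_2-(M_2\cap\mathcal S)|$. $\mathcal S$ is stable if $k(\alpha)/l(\alpha)>1$ for every canonical $\alpha$ with $l(\alpha)\ne0$. Level construction: $\mathcal S_0=\mathcal S$, $\bar\mu=\mu$ on $\mathcal S_0$. For $i\ge1$, with $L_{i-1}=\bigcup_{j<i}\mathcal S_j$ already assigned, for canonical $\alpha:M_1\to M_2$ let $\hat M_2=M_2\cap L_{i-1}$, $k_i(\alpha)=\bar\mu(M_1)-\bar\mu(\hat M_2)$, $l_i(\alpha)=|M_2|-|\hat M_2|$; $\mu_i=\min k_i(\alpha)/l_i(\alpha)$ over canonical $\alpha$ with $l_i(\alpha)\ne0$ (attained); reactions attaining it are $i$-levelizing; $\mathcal S_i$ is the set of polymers in products of $i$-levelizing reactions not in $L_{i-1}$, each assigned $\bar\mu(P)=\mu_i$. Repeat until all polymers are assigned. -}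

module Defs where

open import Data.Nat as ℕ using (ℕ; zero; suc; _∸_; _<ᵇ_)
open import Data.Fin using (Fin; zero; suc)
open import Data.Fin.Subset using (Subset; _∈_; _∉_)
open import Data.Vec using (lookup)
open import Data.Bool using (Bool; true; false; if_then_else_)
open import Data.Product using (Σ; ∃; ∃₂; _×_; _,_)
open import Data.Sum using (_⊎_)
open import Function using (_∘_)
open import Relation.Binary.PropositionalEquality using (_≡_; _≢_; _≗_)
open import Relation.Nullary using (¬_)
open import Algebra.Structures using (IsCommutativeRing)
open import Relation.Binary.Structures using (IsStrictTotalOrder)

-- An abstract ordered field (stand-in for ℝ, which agda-stdlib lacks).

record OrderedField : Set₁ where
  infixl 6 _+_ _-_
  infixl 7 _*_
  infix 4 _<_ _≤_
  field
    Carrier : Set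
    _+_ _*_ : Carrier → Carrier → Carrier
    -_ : Carrier → Carrier
    0# 1# : Carrier
    _<_ : Carrier → Carrier → Set
    isCommutativeRing : IsCommutativeRing _≡_ _+_ _*_ -_ 0# 1#
    isStrictTotalOrder : IsStrictTotalOrder _≡_ _<_
    +-mono-< : ∀ {a b} c → a < b → a + c < b + c
    *-pos : ∀ {a b} → 0# < a → 0# < b → 0# < a * b
    inverse : ∀ a → a ≢ 0# → ∃ λ b → a * b ≡ 1#

  _-_ : Carrier → Carrier → Carrier
  a - b = a + (- b)

  _≤_ : Carrier → Carrier → Set
  a ≤ b = a < b ⊎ a ≡ b

  fromℕ : ℕ → Carrier
  fromℕ zero = 0#
  fromℕ (suc k) = 1# + fromℕ k

  ∑F : ∀ {n} → (Fin n → Carrier) → Carrier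
  ∑F {zero} f = 0#
  ∑F {suc n} f = f zero + ∑F (f ∘ suc)

∑ : ∀ {n} → (Fin n → ℕ) → ℕ
∑ {zero} f = 0
∑ {suc n} f = f zero ℕ.+ ∑ (f ∘ suc)

Multiset : ℕ → Set
Multiset n = Fin n → ℕ

size : ∀ {n} → Multiset n → ℕ
size M = ∑ M

_−ᴹ_ : ∀ {n} → Multiset n → Multiset n → Multiset n
(M₁ −ᴹ M₂) P = M₁ P ∸ M₂ P

_∩ᴹ_ : ∀ {n} → Multiset n → Subset n → Multiset n
(M ∩ᴹ S) P = if lookup S P then M P else 0

-- Injectivity of the polymer-composition map (Ψ ⊆ ℕ^{Ψ⁰} is a set)
InjectiveComp : ∀ {m n} → (Fin n → Fin m → ℕ) → Set
InjectiveComp comp = ∀ P Q → comp P ≗ comp Q → P ≡ Q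

-- The setting: field F, monomers Fin m, polymers Fin n with
-- composition comp P a = P[a], on-target set S.

module Setting (F : OrderedField) {m n : ℕ}
               (comp : Fin n → Fin m → ℕ) (S : Subset n) where
  open OrderedField F

  Reconf : Multiset n → Multiset n → Set
  Reconf M₁ M₂ = ∀ a → ∑ (λ P → M₁ P ℕ.* comp P a) ≡ ∑ (λ P → M₂ P ℕ.* comp P a)

  InS : Multiset n → Set
  InS M = ∀ P → P ∉ S → M P ≡ 0

  weight : (Fin n → Carrier) → Multiset n → Carrier
  weight ν M = ∑F (λ P → fromℕ (M P) * ν P)

  -- μ is only meaningful on S; its values off S are never used below.
  IsOnTarget : (Fin n → Carrier) → Set
  IsOnTarget μ =
      (∀ P → P ∈ S → (0# < μ P) × (μ P ≤ 1#))
    × (∀ P → ∃₂ λ M M' → InS M × Reconf M M' × (1 ℕ.≤ M' P))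
    × (∀ M₁ M₂ → InS M₁ → InS M₂ → Reconf M₁ M₂ → weight μ M₁ ≡ weight μ M₂)

  Canonical : Multiset n → Multiset n → Set
  Canonical M₁ M₂ = InS M₁ × Reconf M₁ M₂

  k : (Fin n → Carrier) → Multiset n → Multiset n → Carrier
  k μ M₁ M₂ = weight μ M₁ - weight μ (M₂ ∩ᴹ S)

  l : Multiset n → ℕ
  l M₂ = size (M₂ −ᴹ (M₂ ∩ᴹ S))

  -- k(α)/l(α) > 1, written without division (l(α) > 0): l(α) < k(α)
  Stable : (Fin n → Carrier) → Set
  Stable μ = ∀ M₁ M₂ → Canonical M₁ M₂ → l M₂ ≢ 0 → fromℕ (l M₂) < k μ M₁ M₂

  -- Level construction.  lev P = i  means  P ∈ 𝒮ᵢ ;  L_{i-1} = {P | lev P < i}.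
  module Levels (μbar : Fin n → Carrier) (lev : Fin n → ℕ) where

    hat : ℕ → Multiset n → Multiset n
    hat i M P = if lev P <ᵇ i then M P else 0

    kᵢ : ℕ → Multiset n → Multiset n → Carrier
    kᵢ i M₁ M₂ = weight μbar M₁ - weight μbar (hat i M₂)

    lᵢ : ℕ → Multiset n → ℕ
    lᵢ i M₂ = size M₂ ∸ size (hat i M₂)

    -- kᵢ/lᵢ = c  (lᵢ ≠ 0), written as  lᵢ·c = kᵢ
    Levelizing : ℕ → Carrier → Multiset n → Multiset n → Set
    Levelizing i c M₁ M₂ =
      Canonical M₁ M₂ × (lᵢ i M₂ ≢ 0) × (fromℕ (lᵢ i M₂) * c ≡ kᵢ i M₁ M₂)

  record LevelConstruction (μ μbar : Fin n → Carrier) (lev : Fin n → ℕ) : Set where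
    open Levels μbar lev
    field
      N         : ℕ
      μlev      : ℕ → Carrier
      lev-bound : ∀ P → lev P ℕ.≤ N      -- construction ends when all polymers are assigned
      lev0→S    : ∀ P → lev P ≡ 0 → P ∈ S
      S→lev0    : ∀ P → P ∈ S → lev P ≡ 0
      base      : ∀ P → P ∈ S → μbar P ≡ μ P
      -- μᵢ = min kᵢ/lᵢ over canonical α with lᵢ ≠ 0 ...
      lower     : ∀ i → 1 ℕ.≤ i → i ℕ.≤ N → ∀ M₁ M₂ → Canonical M₁ M₂ →
                  lᵢ i M₂ ≢ 0 → fromℕ (lᵢ i M₂) * μlev i ≤ kᵢ i M₁ M₂
      -- ... and the minimum is attained
      attained  : ∀ i → 1 ℕ.≤ i → i ℕ.≤ N → ∃₂ λ M₁ M₂ → Levelizing i (μlev i) M₁ M₂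
      -- 𝒮ᵢ = products of i-levelizing reactions not in L_{i-1}
      level→    : ∀ i → 1 ℕ.≤ i → i ℕ.≤ N → ∀ P → lev P ≡ i →
                  ¬ (lev P ℕ.< i) × ∃₂ λ M₁ M₂ → Levelizing i (μlev i) M₁ M₂ × (1 ℕ.≤ M₂ P)
      →level    : ∀ i → 1 ℕ.≤ i → i ℕ.≤ N → ∀ P → ¬ (lev P ℕ.< i) →
                  (∃₂ λ M₁ M₂ → Levelizing i (μlev i) M₁ M₂ × (1 ℕ.≤ M₂ P)) → lev P ≡ i
      value     : ∀ i → 1 ℕ.≤ i → i ℕ.≤ N → ∀ P → lev P ≡ i → μbar P ≡ μlev i

{-# OPTIONS --safe #-}
module Submission where

open import Defs
open import Data.Nat using (ℕ)
open import Data.Fin using (Fin)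
open import Data.Fin.Subset using (Subset; _∉_)

open import Algebra.Bundles using (CommutativeRing)
open import Algebra.Structures using (IsCommutativeRing)
import Algebra.Properties.CommutativeSemigroup as CommutativeSemigroupProperties
open import Data.Bool using (true; false; if_then_else_; T)
open import Data.Fin using (zero; suc)
open import Data.Fin.Subset using (_∈_)
open import Data.Fin.Subset.Properties using (_∈?_)
open import Data.Nat as ℕ using (zero; suc; _∸_; _<ᵇ_; _≡ᵇ_; z≤n; s≤s)
import Data.Nat.Properties as ℕ
open import Data.Product using (_,_)
open import Data.Sum using (inj₁; inj₂)
open import Data.Unit using (tt)
open import Data.Vec using (lookup)
open import Data.Vec.Properties using ([]=⇒lookup; lookup⇒[]=)
open import Function using (_∘_)
open import Relation.Binary.Bundles using (StrictTotalOrder)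
import Relation.Binary.Reasoning.StrictPartialOrder
open import Relation.Binary.Definitions using (tri<; tri≈; tri>)
open import Relation.Binary.PropositionalEquality
open import Relation.Nullary using (yes; no; contradiction)

-- The minima μᵢ of the level construction are nondecreasing in i. Read an
-- (i+1)-levelizing reaction α at level i: if c of its products lie in 𝒮ᵢ, then
-- lᵢ(α) = lᵢ₊₁(α) + c and kᵢ(α) = kᵢ₊₁(α) + c μᵢ, so the minimality of μᵢ gives
-- lᵢ₊₁(α) μᵢ ≤ kᵢ₊₁(α) = lᵢ₊₁(α) μᵢ₊₁. At level 1 the numbers k₁, l₁ are the k, l
-- of the stability condition, so μ₁ > 1; and every P ∉ 𝒮 has μ̄(P) = μᵢ for
-- some i ≥ 1.

∑-cong : ∀ {n} {f g : Fin n → ℕ} → (∀ P → f P ≡ g P) → ∑ f ≡ ∑ g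
∑-cong {zero} f≗g = refl
∑-cong {suc n} f≗g = cong₂ ℕ._+_ (f≗g zero) (∑-cong (f≗g ∘ suc))

∑-distrib-+ : ∀ {n} (f g : Fin n → ℕ) → ∑ (λ P → f P ℕ.+ g P) ≡ ∑ f ℕ.+ ∑ g
∑-distrib-+ {zero} f g = refl
∑-distrib-+ {suc n} f g =
  trans (cong (f zero ℕ.+ g zero ℕ.+_) (∑-distrib-+ (f ∘ suc) (g ∘ suc)))
        (interchange (f zero) (g zero) (∑ (f ∘ suc)) (∑ (g ∘ suc)))
  where open CommutativeSemigroupProperties ℕ.+-commutativeSemigroup using (interchange)

∑-mono-≤ : ∀ {n} {f g : Fin n → ℕ} → (∀ P → f P ℕ.≤ g P) → ∑ f ℕ.≤ ∑ g
∑-mono-≤ {zero} f≤g = z≤n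
∑-mono-≤ {suc n} f≤g = ℕ.+-mono-≤ (f≤g zero) (∑-mono-≤ (f≤g ∘ suc))

∑-distrib-∸ : ∀ {n} (f g : Fin n → ℕ) → (∀ P → g P ℕ.≤ f P) →
              ∑ (λ P → f P ∸ g P) ≡ ∑ f ∸ ∑ g
∑-distrib-∸ f g g≤f = begin
  ∑ (λ P → f P ∸ g P)                   ≡⟨ ℕ.m+n∸n≡m _ (∑ g) ⟨
  ∑ (λ P → f P ∸ g P) ℕ.+ ∑ g ∸ ∑ g     ≡⟨ cong (_∸ ∑ g) (∑-distrib-+ (λ P → f P ∸ g P) g) ⟨
  ∑ (λ P → f P ∸ g P ℕ.+ g P) ∸ ∑ g     ≡⟨ cong (_∸ ∑ g) (∑-cong (ℕ.m∸n+n≡m ∘ g≤f)) ⟩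
  ∑ f ∸ ∑ g                             ∎
  where open ≡-Reasoning

m∸n≡m∸[n+o]+o : ∀ {m} n o → n ℕ.+ o ℕ.≤ m → m ∸ n ≡ m ∸ (n ℕ.+ o) ℕ.+ o
m∸n≡m∸[n+o]+o {m} n o n+o≤m = begin
  m ∸ n                 ≡⟨ ℕ.m∸n+n≡m o≤m∸n ⟨
  m ∸ n ∸ o ℕ.+ o       ≡⟨ cong (ℕ._+ o) (ℕ.∸-+-assoc m n o) ⟩
  m ∸ (n ℕ.+ o) ℕ.+ o   ∎
  where
  open ≡-Reasoning
  o≤m∸n : o ℕ.≤ m ∸ n
  o≤m∸n = ℕ.m+n≤o⇒m≤o∸n o (subst (ℕ._≤ m) (ℕ.+-comm n o) n+o≤m)

if-<ᵇ-suc : ∀ a j x → (if a <ᵇ suc j then x else 0) ≡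
                      (if a <ᵇ j then x else 0) ℕ.+ (if a ≡ᵇ j then x else 0)
if-<ᵇ-suc zero    zero    x = refl
if-<ᵇ-suc zero    (suc j) x = sym (ℕ.+-identityʳ x)
if-<ᵇ-suc (suc a) zero    x = refl
if-<ᵇ-suc (suc a) (suc j) x = if-<ᵇ-suc a j x

module OrderedFieldProperties (F : OrderedField) where
  open OrderedField F
  open IsCommutativeRing isCommutativeRing
    using (+-comm; +-assoc; +-identityˡ; +-identityʳ; -‿inverseˡ; -‿inverseʳ; distribʳ;
           *-identityˡ; *-identityʳ; zeroˡ)

  commutativeRing : CommutativeRing _ _
  commutativeRing = record { isCommutativeRing = isCommutativeRing }

  open CommutativeRing commutativeRing using (+-abelianGroup; +-commutativeSemigroup)

  strictTotalOrder : StrictTotalOrder _ _ _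
  strictTotalOrder = record { isStrictTotalOrder = isStrictTotalOrder }

  open StrictTotalOrder strictTotalOrder using (compare; irrefl; strictPartialOrder)
  module ≤-Reasoning = Relation.Binary.Reasoning.StrictPartialOrder strictPartialOrder
  open ≤-Reasoning

  +-monoʳ-≤ : ∀ {a b} c → a ≤ b → a + c ≤ b + c
  +-monoʳ-≤ c (inj₁ a<b) = inj₁ (+-mono-< c a<b)
  +-monoʳ-≤ c (inj₂ refl) = inj₂ refl

  +-monoˡ-≤ : ∀ {a b} c → a ≤ b → c + a ≤ c + b
  +-monoˡ-≤ {a} {b} c a≤b = subst₂ _≤_ (+-comm a c) (+-comm b c) (+-monoʳ-≤ c a≤b)

  +-mono-≤ : ∀ {a b c d} → a ≤ b → c ≤ d → a + c ≤ b + d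
  +-mono-≤ {a} {b} {c} {d} a≤b c≤d = begin
    a + c  ≤⟨ +-monoʳ-≤ c a≤b ⟩
    b + c  ≤⟨ +-monoˡ-≤ b c≤d ⟩
    b + d  ∎

  +-mono-<-≤ : ∀ {a b c d} → a < b → c ≤ d → a + c < b + d
  +-mono-<-≤ {a} {b} {c} {d} a<b c≤d = begin-strict
    a + c  <⟨ +-mono-< c a<b ⟩
    b + c  ≤⟨ +-monoˡ-≤ b c≤d ⟩
    b + d  ∎

  +-cancelʳ-≤ : ∀ {a b} c → a + c ≤ b + c → a ≤ b
  +-cancelʳ-≤ {a} {b} c a+c≤b+c = subst₂ _≤_ (x+c-c≡x a) (x+c-c≡x b) (+-monoʳ-≤ (- c) a+c≤b+c)
    where
    x+c-c≡x : ∀ x → x + c - c ≡ x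
    x+c-c≡x x = trans (+-assoc x c (- c)) (trans (cong (x +_) (-‿inverseʳ c)) (+-identityʳ x))

  x-y≡x-[y+z]+z : ∀ x y z → x - y ≡ x - (y + z) + z
  x-y≡x-[y+z]+z x y z = begin-equality
    x - y                    ≡⟨ cong (x +_) (+-identityʳ (- y)) ⟨
    x + (- y + 0#)           ≡⟨ cong (λ w → x + (- y + w)) (-‿inverseˡ z) ⟨
    x + (- y + (- z + z))    ≡⟨ cong (x +_) (+-assoc (- y) (- z) z) ⟨
    x + (- y + - z + z)      ≡⟨ +-assoc x (- y + - z) z ⟨
    x + (- y + - z) + z      ≡⟨ cong (λ w → x + w + z) (⁻¹-∙-comm y z) ⟩
    x - (y + z) + z          ∎
    where open import Algebra.Properties.AbelianGroup +-abelianGroup using (⁻¹-∙-comm)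

  fromℕ-+-* : ∀ a b x → fromℕ (a ℕ.+ b) * x ≡ fromℕ a * x + fromℕ b * x
  fromℕ-+-* a b x = trans (cong (_* x) (fromℕ-+ a b)) (distribʳ x (fromℕ a) (fromℕ b))
    where
    fromℕ-+ : ∀ a b → fromℕ (a ℕ.+ b) ≡ fromℕ a + fromℕ b
    fromℕ-+ zero b = sym (+-identityˡ (fromℕ b))
    fromℕ-+ (suc a) b = trans (cong (1# +_) (fromℕ-+ a b)) (sym (+-assoc 1# (fromℕ a) (fromℕ b)))

  fromℕ-suc-* : ∀ l x → fromℕ (suc l) * x ≡ x + fromℕ l * x
  fromℕ-suc-* l x = trans (distribʳ x 1# (fromℕ l)) (cong (_+ fromℕ l * x) (*-identityˡ x))

  fromℕ*-cong : ∀ l {x y} → (l ≢ 0 → x ≡ y) → fromℕ l * x ≡ fromℕ l * y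
  fromℕ*-cong zero    {x} {y} _   = trans (zeroˡ x) (sym (zeroˡ y))
  fromℕ*-cong (suc l)         x≡y = cong (fromℕ (suc l) *_) (x≡y ℕ.1+n≢0)

  fromℕ*-mono-≤ : ∀ l {x y} → x ≤ y → fromℕ l * x ≤ fromℕ l * y
  fromℕ*-mono-≤ zero    _   = inj₂ (fromℕ*-cong zero λ 0≢0 → contradiction refl 0≢0)
  fromℕ*-mono-≤ (suc l) {x} {y} x≤y =
    subst₂ _≤_ (sym (fromℕ-suc-* l x)) (sym (fromℕ-suc-* l y)) (+-mono-≤ x≤y (fromℕ*-mono-≤ l x≤y))

  fromℕ*-mono-< : ∀ l {x y} → l ≢ 0 → x < y → fromℕ l * x < fromℕ l * y
  fromℕ*-mono-< zero    l≢0 _ = contradiction refl l≢0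
  fromℕ*-mono-< (suc l) {x} {y} _ x<y =
    subst₂ _<_ (sym (fromℕ-suc-* l x)) (sym (fromℕ-suc-* l y)) (+-mono-<-≤ x<y (fromℕ*-mono-≤ l (inj₁ x<y)))

  fromℕ*-cancel-< : ∀ l {x y} → fromℕ l * x < fromℕ l * y → x < y
  fromℕ*-cancel-< l {x} {y} lx<ly with compare x y
  ... | tri< x<y _ _ = x<y
  ... | tri≈ _ refl _ = contradiction lx<ly (irrefl refl)
  ... | tri> _ _ y<x = contradiction lx<lx (irrefl refl)
    where
    lx<lx : fromℕ l * x < fromℕ l * x
    lx<lx = begin-strict
      fromℕ l * x  <⟨ lx<ly ⟩
      fromℕ l * y  ≤⟨ fromℕ*-mono-≤ l (inj₁ y<x) ⟩
      fromℕ l * x  ∎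

  fromℕ*-cancel-≤ : ∀ l {x y} → l ≢ 0 → fromℕ l * x ≤ fromℕ l * y → x ≤ y
  fromℕ*-cancel-≤ l {x} {y} l≢0 lx≤ly with compare x y
  ... | tri< x<y _ _ = inj₁ x<y
  ... | tri≈ _ x≡y _ = inj₂ x≡y
  ... | tri> _ _ y<x = contradiction lx<lx (irrefl refl)
    where
    lx<lx : fromℕ l * x < fromℕ l * x
    lx<lx = begin-strict
      fromℕ l * x  ≤⟨ lx≤ly ⟩
      fromℕ l * y  <⟨ fromℕ*-mono-< l l≢0 y<x ⟩
      fromℕ l * x  ∎

  ∑F-cong : ∀ {n} {f g : Fin n → Carrier} → (∀ P → f P ≡ g P) → ∑F f ≡ ∑F g
  ∑F-cong {zero} f≗g = refl
  ∑F-cong {suc n} f≗g = cong₂ _+_ (f≗g zero) (∑F-cong (f≗g ∘ suc))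

  ∑F-distrib-+ : ∀ {n} (f g : Fin n → Carrier) → ∑F (λ P → f P + g P) ≡ ∑F f + ∑F g
  ∑F-distrib-+ {zero} f g = sym (+-identityʳ 0#)
  ∑F-distrib-+ {suc n} f g =
    trans (cong (f zero + g zero +_) (∑F-distrib-+ (f ∘ suc) (g ∘ suc)))
          (interchange (f zero) (g zero) (∑F (f ∘ suc)) (∑F (g ∘ suc)))
    where open CommutativeSemigroupProperties +-commutativeSemigroup using (interchange)

  ∑F-fromℕ-* : ∀ {n} (f : Fin n → ℕ) x → ∑F (λ P → fromℕ (f P) * x) ≡ fromℕ (∑ f) * x
  ∑F-fromℕ-* {zero} f x = sym (zeroˡ x)
  ∑F-fromℕ-* {suc n} f x =
    trans (cong (fromℕ (f zero) * x +_) (∑F-fromℕ-* (f ∘ suc) x)) (sym (fromℕ-+-* (f zero) (∑ (f ∘ suc)) x))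

module SettingProperties (F : OrderedField) {m n : ℕ} (comp : Fin n → Fin m → ℕ) (S : Subset n) where
  open OrderedField F
  open OrderedFieldProperties F
  open Setting F comp S

  weight-cong : ∀ {ν ν' : Fin n → Carrier} (M : Multiset n) →
                (∀ P → M P ≢ 0 → ν P ≡ ν' P) → weight ν M ≡ weight ν' M
  weight-cong M ν≗ν' = ∑F-cong (λ P → fromℕ*-cong (M P) (ν≗ν' P))

  weight-congʳ : ∀ ν {M M' : Multiset n} → (∀ P → M P ≡ M' P) → weight ν M ≡ weight ν M'
  weight-congʳ ν M≗M' = ∑F-cong (λ P → cong (λ c → fromℕ c * ν P) (M≗M' P))

  weight-distrib-+ : ∀ ν (M M' : Multiset n) →
                     weight ν (λ P → M P ℕ.+ M' P) ≡ weight ν M + weight ν M'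
  weight-distrib-+ ν M M' = trans (∑F-cong (λ P → fromℕ-+-* (M P) (M' P) (ν P)))
                                  (∑F-distrib-+ (λ P → fromℕ (M P) * ν P) (λ P → fromℕ (M' P) * ν P))

  weight-const : ∀ {ν x} (M : Multiset n) → (∀ P → M P ≢ 0 → ν P ≡ x) →
                 weight ν M ≡ fromℕ (size M) * x
  weight-const {x = x} M ν≡x = trans (weight-cong M ν≡x) (∑F-fromℕ-* M x)

  InS⇒∈S : ∀ {M} → InS M → ∀ P → M P ≢ 0 → P ∈ S
  InS⇒∈S M∈ℕ^S P M[P]≢0 with P ∈? S
  ... | yes P∈S = P∈S
  ... | no  P∉S = contradiction (M∈ℕ^S P P∉S) M[P]≢0

  ∩ᴹ-InS : ∀ (M : Multiset n) → InS (M ∩ᴹ S)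
  ∩ᴹ-InS M P P∉S with lookup S P in S[P]
  ... | true  = contradiction (lookup⇒[]= P S S[P]) P∉S
  ... | false = refl

  ∩ᴹ-≤ : ∀ (M : Multiset n) P → (M ∩ᴹ S) P ℕ.≤ M P
  ∩ᴹ-≤ M P with lookup S P
  ... | true  = ℕ.≤-refl
  ... | false = z≤n

  l≡size∸size∩ᴹ : ∀ M → l M ≡ size M ∸ size (M ∩ᴹ S)
  l≡size∸size∩ᴹ M = ∑-distrib-∸ M (M ∩ᴹ S) (∩ᴹ-≤ M)

module LevelConstructionProperties
  (F : OrderedField) {m n : ℕ} (comp : Fin n → Fin m → ℕ) (S : Subset n)
  (μ μbar : Fin n → OrderedField.Carrier F) (lev : Fin n → ℕ)
  (LC : Setting.LevelConstruction F comp S μ μbar lev) where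
  open OrderedField F
  open OrderedFieldProperties F
  open Setting F comp S
  open SettingProperties F comp S
  open Levels μbar lev
  open IsCommutativeRing isCommutativeRing using (*-identityʳ)
  open LevelConstruction LC
  open ≤-Reasoning

  atLevel : ℕ → Multiset n → Multiset n
  atLevel j M P = if lev P ≡ᵇ j then M P else 0

  atLevel-lev : ∀ j M P → atLevel j M P ≢ 0 → lev P ≡ j
  atLevel-lev j M P M[P]≢0 with lev P ≡ᵇ j in lev≡ᵇj
  ... | true  = ℕ.≡ᵇ⇒≡ (lev P) j (subst T (sym lev≡ᵇj) tt)
  ... | false = contradiction refl M[P]≢0

  hat-≤ : ∀ i M P → hat i M P ℕ.≤ M P
  hat-≤ i M P with lev P <ᵇ i
  ... | true  = ℕ.≤-refl
  ... | false = z≤n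

  hat-suc : ∀ j M P → hat (suc j) M P ≡ hat j M P ℕ.+ atLevel j M P
  hat-suc j M P = if-<ᵇ-suc (lev P) j (M P)

  hat-one : ∀ M P → hat 1 M P ≡ (M ∩ᴹ S) P
  hat-one M P with lev P in lev≡ | lookup S P in S[P]
  ... | zero  | true  = refl
  ... | zero  | false = contradiction (trans (sym ([]=⇒lookup (lev0→S P lev≡))) S[P]) λ ()
  ... | suc _ | true  = contradiction (trans (sym lev≡) (S→lev0 P (lookup⇒[]= P S S[P]))) λ ()
  ... | suc _ | false = refl

  size-hat-suc : ∀ j M → size (hat (suc j) M) ≡ size (hat j M) ℕ.+ size (atLevel j M)
  size-hat-suc j M = trans (∑-cong (hat-suc j M)) (∑-distrib-+ (hat j M) (atLevel j M))

  lᵢ-suc : ∀ j M → lᵢ j M ≡ lᵢ (suc j) M ℕ.+ size (atLevel j M)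
  lᵢ-suc j M = trans (m∸n≡m∸[n+o]+o (size (hat j M)) (size (atLevel j M)) hat≤M)
                     (cong (λ s → size M ∸ s ℕ.+ size (atLevel j M)) (sym (size-hat-suc j M)))
    where
    hat≤M : size (hat j M) ℕ.+ size (atLevel j M) ℕ.≤ size M
    hat≤M = subst (ℕ._≤ size M) (size-hat-suc j M) (∑-mono-≤ (hat-≤ (suc j) M))

  kᵢ-suc : ∀ j → 1 ℕ.≤ j → j ℕ.≤ N → ∀ M₁ M₂ →
           kᵢ j M₁ M₂ ≡ kᵢ (suc j) M₁ M₂ + fromℕ (size (atLevel j M₂)) * μlev j
  kᵢ-suc j 1≤j j≤N M₁ M₂ = begin-equality
    weight μbar M₁ - weight μbar (hat j M₂)              ≡⟨ x-y≡x-[y+z]+z _ _ _ ⟩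
    weight μbar M₁ - (weight μbar (hat j M₂) + C) + C    ≡⟨ cong (λ w → weight μbar M₁ - w + C) weight-hat-suc ⟨
    weight μbar M₁ - weight μbar (hat (suc j) M₂) + C    ∎
    where
    C : Carrier
    C = fromℕ (size (atLevel j M₂)) * μlev j
    weight-hat-suc : weight μbar (hat (suc j) M₂) ≡ weight μbar (hat j M₂) + C
    weight-hat-suc = trans (weight-congʳ μbar (hat-suc j M₂)) (trans
      (weight-distrib-+ μbar (hat j M₂) (atLevel j M₂))
      (cong (weight μbar (hat j M₂) +_)
        (weight-const (atLevel j M₂) (λ P → value j 1≤j j≤N P ∘ atLevel-lev j M₂ P))))

  l₁≡l : ∀ M → lᵢ 1 M ≡ l M
  l₁≡l M = trans (cong (size M ∸_) (∑-cong (hat-one M))) (sym (l≡size∸size∩ᴹ M))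

  k₁≡k : ∀ {M₁} M₂ → InS M₁ → kᵢ 1 M₁ M₂ ≡ k μ M₁ M₂
  k₁≡k {M₁} M₂ M₁∈ℕ^S = cong₂ _-_
    (weight-cong M₁ (λ P → base P ∘ InS⇒∈S M₁∈ℕ^S P))
    (trans (weight-congʳ μbar (hat-one M₂))
           (weight-cong (M₂ ∩ᴹ S) (λ P → base P ∘ InS⇒∈S (∩ᴹ-InS M₂) P)))

  μlev-mono : ∀ j → 1 ℕ.≤ j → suc j ℕ.≤ N → μlev j ≤ μlev (suc j)
  μlev-mono j 1≤j 1+j≤N with attained (suc j) (s≤s z≤n) 1+j≤N
  ... | M₁ , M₂ , canonical , l≢0 , l*μ≡k = fromℕ*-cancel-≤ l′ l≢0 (+-cancelʳ-≤ C (begin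
    fromℕ l′ * μlev j + C                  ≡⟨ fromℕ-+-* l′ c (μlev j) ⟨
    fromℕ (l′ ℕ.+ c) * μlev j              ≡⟨ cong (λ t → fromℕ t * μlev j) (lᵢ-suc j M₂) ⟨
    fromℕ (lᵢ j M₂) * μlev j              ≤⟨ lower j 1≤j j≤N M₁ M₂ canonical lⱼ≢0 ⟩
    kᵢ j M₁ M₂                            ≡⟨ kᵢ-suc j 1≤j j≤N M₁ M₂ ⟩
    kᵢ (suc j) M₁ M₂ + C                  ≡⟨ cong (_+ C) l*μ≡k ⟨
    fromℕ l′ * μlev (suc j) + C            ∎))
    where
    l′ c : ℕ
    l′ = lᵢ (suc j) M₂
    c = size (atLevel j M₂)
    C : Carrier
    C = fromℕ c * μlev j
    j≤N : j ℕ.≤ N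
    j≤N = ℕ.≤-trans (ℕ.n≤1+n j) 1+j≤N
    lⱼ≢0 : lᵢ j M₂ ≢ 0
    lⱼ≢0 = l≢0 ∘ ℕ.m+n≡0⇒m≡0 l′ ∘ trans (sym (lᵢ-suc j M₂))

  1<μlev₁ : Stable μ → 1 ℕ.≤ N → 1# < μlev 1
  1<μlev₁ stable 1≤N with attained 1 ℕ.≤-refl 1≤N
  ... | M₁ , M₂ , canonical@(M₁∈ℕ^S , _) , l₁≢0 , l₁*μ≡k₁ = fromℕ*-cancel-< (lᵢ 1 M₂) (begin-strict
    fromℕ (lᵢ 1 M₂) * 1#        ≡⟨ *-identityʳ _ ⟩
    fromℕ (lᵢ 1 M₂)             ≡⟨ cong fromℕ (l₁≡l M₂) ⟩
    fromℕ (l M₂)                <⟨ stable M₁ M₂ canonical (l₁≢0 ∘ trans (l₁≡l M₂)) ⟩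
    k μ M₁ M₂                   ≡⟨ k₁≡k M₂ M₁∈ℕ^S ⟨
    kᵢ 1 M₁ M₂                  ≡⟨ l₁*μ≡k₁ ⟨
    fromℕ (lᵢ 1 M₂) * μlev 1    ∎)

  1<μlev : Stable μ → ∀ i → 1 ℕ.≤ i → i ℕ.≤ N → 1# < μlev i
  1<μlev stable (suc zero)    _ 1≤N   = 1<μlev₁ stable 1≤N
  1<μlev stable (suc (suc j)) _ 2+j≤N = begin-strict
    1#                <⟨ 1<μlev stable (suc j) (s≤s z≤n) (ℕ.≤-trans (ℕ.n≤1+n (suc j)) 2+j≤N) ⟩
    μlev (suc j)      ≤⟨ μlev-mono (suc j) (s≤s z≤n) 2+j≤N ⟩
    μlev (suc (suc j)) ∎

corollary17 : (F : OrderedField) {m n : ℕ} (comp : Fin n → Fin m → ℕ) →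
    InjectiveComp comp → (S : Subset n) (μ : Fin n → OrderedField.Carrier F) →
    Setting.IsOnTarget F comp S μ → Setting.Stable F comp S μ →
    (μbar : Fin n → OrderedField.Carrier F) (lev : Fin n → ℕ) →
    Setting.LevelConstruction F comp S μ μbar lev →
    ∀ P → P ∉ S → OrderedField._<_ F (OrderedField.1# F) (μbar P)
corollary17 F comp _ S μ _ stable μbar lev LC P P∉S = begin-strict
  1#             <⟨ 1<μlev stable (lev P) 1≤lev[P] (lev-bound P) ⟩
  μlev (lev P)   ≡⟨ value (lev P) 1≤lev[P] (lev-bound P) P refl ⟨
  μbar P         ∎
  where
  open OrderedField F using (1#)
  open OrderedFieldProperties F using (module ≤-Reasoning)
  open ≤-Reasoning
  open Setting F comp S using (module LevelConstruction)
  open LevelConstruction LC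
  open LevelConstructionProperties F comp S μ μbar lev LC
  1≤lev[P] : 1 ℕ.≤ lev P
  1≤lev[P] = ℕ.n≢0⇒n>0 (P∉S ∘ lev0→S P)
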